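{- Let $G$ be a finite abelian group with identity $e$, $S\subseteq G\setminus\{e\}$ with $S=S^{ -1}$, such that $\mathrm{Cay}(G,S)$ is connected. Let $C$ be a regular clique of $\mathrm{Cay}(G,S)$ of size $3$ and nexus $1$ containing $e$. Then $C$ is a subgroup of $G$ of order $3$.
   Context: All graphs are finite, undirected and simple. The Cayley graph $\mathrm{Cay}(G,S)$ has vertex set $G$, with $x\sim y$ iff $xy^{ -1}\in S$. A clique $C$ is regular with nexus $a$ if every vertex outside $C$ is adjacent to exactly $a$ vertices of $C$. -}

module Defs where

open import Data.Nat using (ℕ)
open import Data.Fin using (Fin)
open import Data.Fin.Subset using (Subset; _∈_; _∉_; _∩_; ∣_∣)
open import Data.Fin.Subset.Properties using (_∈?_)
open import Data.Vec using (tabulate)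
open import Relation.Nullary using (¬_; does)
open import Relation.Binary.PropositionalEquality using (_≡_; _≢_)
open import Relation.Binary.Construct.Closure.ReflexiveTransitive using (Star)
open import Algebra.Structures using (IsAbelianGroup)
open import Data.Product using (_×_)

record FiniteAbelianGroup : Set where
  field
    n     : ℕ
    _∙_   : Fin n → Fin n → Fin n
    e     : Fin n
    _⁻¹   : Fin n → Fin n
    isAbelianGroup : IsAbelianGroup _≡_ _∙_ e _⁻¹
  infixl 7 _∙_
  infix 8 _⁻¹

module _ (G : FiniteAbelianGroup) where
  open FiniteAbelianGroup G

  IsConnectionSet : Subset n → Set
  IsConnectionSet S = (e ∉ S) × (∀ x → x ∈ S → x ⁻¹ ∈ S)

  Adj : Subset n → Fin n → Fin n → Set
  Adj S x y = (x ∙ y ⁻¹) ∈ S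

  nbhd : Subset n → Fin n → Subset n
  nbhd S x = tabulate (λ y → does ((x ∙ y ⁻¹) ∈? S))

  Connected : Subset n → Set
  Connected S = ∀ x y → Star (Adj S) x y

  IsClique : Subset n → Subset n → Set
  IsClique S C = ∀ x y → x ∈ C → y ∈ C → x ≢ y → Adj S x y

  IsRegularClique : Subset n → Subset n → ℕ → Set
  IsRegularClique S C a =
    IsClique S C × (∀ x → x ∉ C → ∣ C ∩ nbhd S x ∣ ≡ a)

  IsSubgroup : Subset n → Set
  IsSubgroup C = (e ∈ C) × (∀ x y → x ∈ C → y ∈ C → (x ∙ y) ∈ C)
                         × (∀ x → x ∈ C → x ⁻¹ ∈ C)

-- Write C = {e, a, b}. In an abelian group the quotient x = a b⁻¹ is adjacent
-- to both e and a, since x e⁻¹ = a b⁻¹ and x a⁻¹ = b⁻¹ = e b⁻¹ lie in S by the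
-- clique property. Nexus 1 therefore forbids x ∉ C; x = e and x = a are
-- excluded because a ≠ b and b ≠ e, so x = b, i.e. a = b². Symmetrically
-- b = a², hence a = a (a b), so a b = e and C = {e, a, a⁻¹} is a subgroup.
module Submission where

open import Defs
open import Data.Fin.Subset using (Subset; _∈_; ∣_∣)
open import Data.Product using (_×_)
open import Relation.Binary.PropositionalEquality using (_≡_)

open import Data.Nat using (ℕ; suc; _≤_; s≤s; z≤n)
open import Data.Nat.Properties using (suc-injective; ≤-trans)
open import Data.Fin using (Fin; suc; _≟_)
open import Data.Fin.Subset using (_∉_; _∩_; _-_; ⁅_⁆; inside; outside; Nonempty)
open import Data.Fin.Subset.Properties
  using (_∈?_; x∈p∩q⁺; p─⊥≡p; p─q⊆p; x∈p∧x≢y⇒x∈p-y; x∈p⇒∣p-x∣<∣p∣; nonempty?; Empty-unique; ∣⊥∣≡0)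
open import Data.Vec using (_∷_; here; there)
open import Data.Vec.Properties using (lookup∘tabulate; lookup⇒[]=)
open import Data.Product using (_,_; proj₁; proj₂)
open import Data.Sum using (_⊎_; inj₁; inj₂; map₂) renaming (swap to swap⊎)
open import Data.Empty using (⊥-elim)
open import Function using (_∘_)
open import Relation.Nullary using (does; yes; no)
open import Relation.Nullary.Decidable using (dec-true)
open import Relation.Binary.PropositionalEquality
  using (_≢_; refl; sym; trans; cong; subst; module ≡-Reasoning)
open import Algebra.Bundles using (AbelianGroup)
import Algebra.Properties.AbelianGroup as AbelianGroupProperties

private variable n : ℕ

x∉p-x : ∀ (x : Fin n) (p : Subset n) → x ∉ p - x
x∉p-x (suc x) (_ ∷ p) (there x∈p-x) = x∉p-x x p x∈p-x

x∈p-y⇒x≢y : ∀ {x y : Fin n} {p : Subset n} → x ∈ p - y → x ≢ y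
x∈p-y⇒x≢y {x = x} {p = p} x∈p-x refl = x∉p-x x p x∈p-x

x∈p-y⇒x∈p : ∀ {x y : Fin n} {p : Subset n} → x ∈ p - y → x ∈ p
x∈p-y⇒x∈p {y = y} {p = p} = p─q⊆p p ⁅ y ⁆

x∈p⇒x≡y⊎x∈p-y : ∀ {x : Fin n} (y : Fin n) {p : Subset n} → x ∈ p → x ≡ y ⊎ x ∈ p - y
x∈p⇒x≡y⊎x∈p-y {x = x} y x∈p with x ≟ y
... | yes x≡y = inj₁ x≡y
... | no  x≢y = inj₂ (x∈p∧x≢y⇒x∈p-y x∈p x≢y)

∣p∣≡1+∣p-x∣ : ∀ {x : Fin n} {p : Subset n} → x ∈ p → ∣ p ∣ ≡ suc ∣ p - x ∣
∣p∣≡1+∣p-x∣ {p = inside ∷ p}  here        = cong (suc ∘ ∣_∣) (sym (p─⊥≡p p))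
∣p∣≡1+∣p-x∣ {p = inside ∷ p}  (there x∈p) = cong suc (∣p∣≡1+∣p-x∣ x∈p)
∣p∣≡1+∣p-x∣ {p = outside ∷ p} (there x∈p) = ∣p∣≡1+∣p-x∣ x∈p

∣p∣≡1+k⇒∣p-x∣≡k : ∀ {k} {x : Fin n} {p : Subset n} → x ∈ p → ∣ p ∣ ≡ suc k → ∣ p - x ∣ ≡ k
∣p∣≡1+k⇒∣p-x∣≡k x∈p ∣p∣≡1+k = suc-injective (trans (sym (∣p∣≡1+∣p-x∣ x∈p)) ∣p∣≡1+k)

∣p∣≡0⇒x∉p : ∀ {x : Fin n} {p : Subset n} → ∣ p ∣ ≡ 0 → x ∉ p
∣p∣≡0⇒x∉p ∣p∣≡0 x∈p with () ← trans (sym (∣p∣≡1+∣p-x∣ x∈p)) ∣p∣≡0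

∣p∣≡1+k⇒Nonempty : ∀ {n k} (p : Subset n) → ∣ p ∣ ≡ suc k → Nonempty p
∣p∣≡1+k⇒Nonempty {n} p ∣p∣≡1+k with nonempty? p
... | yes ne = ne
... | no ¬ne with () ← trans (sym ∣p∣≡1+k) (trans (cong ∣_∣ (Empty-unique ¬ne)) (∣⊥∣≡0 n))

x∈p⇒y∈p⇒x≢y⇒2≤∣p∣ : ∀ {x y : Fin n} {p : Subset n} → x ∈ p → y ∈ p → x ≢ y → 2 ≤ ∣ p ∣
x∈p⇒y∈p⇒x≢y⇒2≤∣p∣ {x = x} {y = y} {p = p} x∈p y∈p x≢y =
  ≤-trans (s≤s (≤-trans (s≤s z≤n) (x∈p⇒∣p-x∣<∣p∣ y∈p-x))) (x∈p⇒∣p-x∣<∣p∣ x∈p)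
  where
  y∈p-x : y ∈ p - x
  y∈p-x = x∈p∧x≢y⇒x∈p-y y∈p (λ y≡x → x≢y (sym y≡x))

record Enumeration₃ (p : Subset n) (x : Fin n) : Set where
  field
    y z   : Fin n
    y∈p   : y ∈ p
    z∈p   : z ∈ p
    y≢x   : y ≢ x
    z≢x   : z ≢ x
    y≢z   : y ≢ z
    cover : ∀ {w} → w ∈ p → w ≡ x ⊎ w ≡ y ⊎ w ≡ z

swap : ∀ {p : Subset n} {x : Fin n} → Enumeration₃ p x → Enumeration₃ p x
swap E = record
  { y = z ; z = y ; y∈p = z∈p ; z∈p = y∈p ; y≢x = z≢x ; z≢x = y≢x
  ; y≢z = λ z≡y → y≢z (sym z≡y)
  ; cover = map₂ swap⊎ ∘ cover
  }
  where open Enumeration₃ E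

enumerate₃ : ∀ {p : Subset n} {x : Fin n} → ∣ p ∣ ≡ 3 → x ∈ p → Enumeration₃ p x
enumerate₃ {p = p} {x = x} ∣p∣≡3 x∈p = record
  { y = y ; z = z
  ; y∈p = x∈p-y⇒x∈p y∈p-x ; z∈p = x∈p-y⇒x∈p (x∈p-y⇒x∈p z∈p-x-y)
  ; y≢x = x∈p-y⇒x≢y y∈p-x ; z≢x = x∈p-y⇒x≢y (x∈p-y⇒x∈p z∈p-x-y)
  ; y≢z = λ y≡z → x∈p-y⇒x≢y z∈p-x-y (sym y≡z)
  ; cover = cover
  }
  where
  ∣p-x∣≡2 : ∣ p - x ∣ ≡ 2
  ∣p-x∣≡2 = ∣p∣≡1+k⇒∣p-x∣≡k x∈p ∣p∣≡3
  y : Fin _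
  y = proj₁ (∣p∣≡1+k⇒Nonempty (p - x) ∣p-x∣≡2)
  y∈p-x : y ∈ p - x
  y∈p-x = proj₂ (∣p∣≡1+k⇒Nonempty (p - x) ∣p-x∣≡2)
  ∣p-x-y∣≡1 : ∣ p - x - y ∣ ≡ 1
  ∣p-x-y∣≡1 = ∣p∣≡1+k⇒∣p-x∣≡k y∈p-x ∣p-x∣≡2
  z : Fin _
  z = proj₁ (∣p∣≡1+k⇒Nonempty (p - x - y) ∣p-x-y∣≡1)
  z∈p-x-y : z ∈ p - x - y
  z∈p-x-y = proj₂ (∣p∣≡1+k⇒Nonempty (p - x - y) ∣p-x-y∣≡1)
  cover : ∀ {w} → w ∈ p → w ≡ x ⊎ w ≡ y ⊎ w ≡ z
  cover w∈p with x∈p⇒x≡y⊎x∈p-y x w∈p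
  ... | inj₁ w≡x = inj₁ w≡x
  ... | inj₂ w∈p-x with x∈p⇒x≡y⊎x∈p-y y w∈p-x
  ... | inj₁ w≡y = inj₂ (inj₁ w≡y)
  ... | inj₂ w∈p-x-y with x∈p⇒x≡y⊎x∈p-y z w∈p-x-y
  ... | inj₁ w≡z = inj₂ (inj₂ w≡z)
  ... | inj₂ w∈p-x-y-z = ⊥-elim (∣p∣≡0⇒x∉p (∣p∣≡1+k⇒∣p-x∣≡k z∈p-x-y ∣p-x-y∣≡1) w∈p-x-y-z)

module RegularClique (G : FiniteAbelianGroup) (S C : Subset (FiniteAbelianGroup.n G))
  (clique : IsClique G S C)
  (nexus₁ : ∀ x → x ∉ C → ∣ C ∩ nbhd G S x ∣ ≡ 1)
  (e∈C : FiniteAbelianGroup.e G ∈ C)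
  where

  open FiniteAbelianGroup G
  open ≡-Reasoning

  abelianGroup : AbelianGroup _ _
  abelianGroup = record { isAbelianGroup = isAbelianGroup }

  open AbelianGroup abelianGroup using (assoc; comm; identityˡ; identityʳ)
  open AbelianGroupProperties abelianGroup
    using (xyx⁻¹≈y; x∙y⁻¹≈ε⇒x≈y; identityʳ-unique; ⁻¹-injective; ε⁻¹≈ε; inverseʳ-unique; //-rightDividesˡ)

  Adj⇒∈nbhd : ∀ {x y} → Adj G S x y → y ∈ nbhd G S x
  Adj⇒∈nbhd {x} {y} x∼y = lookup⇒[]= y _
    (trans (lookup∘tabulate (λ z → does ((x ∙ z ⁻¹) ∈? S)) y) (dec-true ((x ∙ y ⁻¹) ∈? S) x∼y))

  unique-neighbour : ∀ {x y z} → x ∉ C → y ∈ C → z ∈ C → Adj G S x y → Adj G S x z → y ≡ z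
  unique-neighbour {x} {y} {z} x∉C y∈C z∈C x∼y x∼z with y ≟ z
  ... | yes y≡z = y≡z
  ... | no y≢z with s≤s () ← subst (2 ≤_) (nexus₁ x x∉C)
        (x∈p⇒y∈p⇒x≢y⇒2≤∣p∣ (x∈p∩q⁺ (y∈C , Adj⇒∈nbhd x∼y)) (x∈p∩q⁺ (z∈C , Adj⇒∈nbhd x∼z)) y≢z)

  module _ (E : Enumeration₃ C e) where
    open Enumeration₃ E renaming (y to a; z to b; y∈p to a∈C; z∈p to b∈C; y≢x to a≢e; z≢x to b≢e; y≢z to a≢b)

    quotient-adjacent-e : Adj G S (a ∙ b ⁻¹) e
    quotient-adjacent-e = subst (_∈ S) (sym (trans (cong (a ∙ b ⁻¹ ∙_) ε⁻¹≈ε) (identityʳ _)))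
      (clique a b a∈C b∈C a≢b)

    quotient-adjacent-a : Adj G S (a ∙ b ⁻¹) a
    quotient-adjacent-a = subst (_∈ S) (trans (identityˡ (b ⁻¹)) (sym (xyx⁻¹≈y a (b ⁻¹))))
      (clique e b e∈C b∈C (λ e≡b → b≢e (sym e≡b)))

    quotient∈C : a ∙ b ⁻¹ ∈ C
    quotient∈C with a ∙ b ⁻¹ ∈? C
    ... | yes q∈C = q∈C
    ... | no q∉C = ⊥-elim (a≢e (sym
          (unique-neighbour q∉C e∈C a∈C quotient-adjacent-e quotient-adjacent-a)))

    a≡b∙b : a ≡ b ∙ b
    a≡b∙b with cover quotient∈C
    ... | inj₁ q≡e = ⊥-elim (a≢b (x∙y⁻¹≈ε⇒x≈y a b q≡e))
    ... | inj₂ (inj₁ q≡a) = ⊥-elim (b≢e (⁻¹-injective (trans (identityʳ-unique a (b ⁻¹) q≡a) (sym ε⁻¹≈ε))))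
    ... | inj₂ (inj₂ q≡b) = trans (sym (//-rightDividesˡ b a)) (cong (_∙ b) q≡b)

  module _ (E : Enumeration₃ C e) where
    open Enumeration₃ E renaming (y to a; z to b; y∈p to a∈C; z∈p to b∈C)

    b≡a∙a : b ≡ a ∙ a
    b≡a∙a = a≡b∙b (swap E)

    a∙b≡e : a ∙ b ≡ e
    a∙b≡e = identityʳ-unique a (a ∙ b) (sym (begin
      a             ≡⟨ a≡b∙b E ⟩
      b ∙ b         ≡⟨ cong (_∙ b) b≡a∙a ⟩
      (a ∙ a) ∙ b   ≡⟨ assoc a a b ⟩
      a ∙ (a ∙ b)   ∎))

    b∙a≡e : b ∙ a ≡ e
    b∙a≡e = trans (comm b a) a∙b≡e

    ∙-closed : ∀ x y → x ∈ C → y ∈ C → x ∙ y ∈ C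
    ∙-closed x y x∈C y∈C with cover x∈C | cover y∈C
    ... | inj₁ refl        | _                = subst (_∈ C) (sym (identityˡ y)) y∈C
    ... | inj₂ _           | inj₁ refl        = subst (_∈ C) (sym (identityʳ x)) x∈C
    ... | inj₂ (inj₁ refl) | inj₂ (inj₁ refl) = subst (_∈ C) b≡a∙a b∈C
    ... | inj₂ (inj₁ refl) | inj₂ (inj₂ refl) = subst (_∈ C) (sym a∙b≡e) e∈C
    ... | inj₂ (inj₂ refl) | inj₂ (inj₁ refl) = subst (_∈ C) (sym b∙a≡e) e∈C
    ... | inj₂ (inj₂ refl) | inj₂ (inj₂ refl) = subst (_∈ C) (a≡b∙b E) a∈C

    ⁻¹-closed : ∀ x → x ∈ C → x ⁻¹ ∈ C
    ⁻¹-closed x x∈C with cover x∈C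
    ... | inj₁ refl        = subst (_∈ C) (sym ε⁻¹≈ε) e∈C
    ... | inj₂ (inj₁ refl) = subst (_∈ C) (inverseʳ-unique a b a∙b≡e) b∈C
    ... | inj₂ (inj₂ refl) = subst (_∈ C) (inverseʳ-unique b a b∙a≡e) a∈C

lemma4p3 : (G : FiniteAbelianGroup) (S C : Subset (FiniteAbelianGroup.n G))
    → IsConnectionSet G S
    → Connected G S
    → IsRegularClique G S C 1
    → ∣ C ∣ ≡ 3
    → FiniteAbelianGroup.e G ∈ C
    → IsSubgroup G C × ∣ C ∣ ≡ 3
lemma4p3 G S C _ _ (clique , nexus₁) ∣C∣≡3 e∈C = (e∈C , ∙-closed E , ⁻¹-closed E) , ∣C∣≡3
  where
  open RegularClique G S C clique nexus₁ e∈C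
  E = enumerate₃ ∣C∣≡3 e∈C
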